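{- Let $\mathfrak S=\{S_1,\dots,S_n\}$, $n\ge1$, be a split system on a multiset $\mathcal M$, and let $G$ be a consistent thin subgraph of $\Gamma(\mathfrak S)$. Let $i,j,k\in\{1,\dots,n\}$ with $i\neq k$, and write $S_i=A|\overline A$, $S_j=B|\overline B$, $S_k=C|\overline C$. If $((\overline A,S_i),(B,S_j))$ and $((\overline C,S_k),(B,S_j))$ are critical arcs of $G$, then $((\overline A,S_i),(C,S_k))$ is a critical arc of $G$.
   Context: A multiset $\mathcal M$ has underlying set $X$ with multiplicities $\mathcal M(x)\ge1$. Unions, inclusions and differences are in the multiset sense. A split of $\mathcal M$ is an unordered pair $\{A,B\}$, written $A|B$, of nonempty submultisets with multiset union $\mathcal M$; $\overline A=\mathcal M-A$. A split system on $\mathcal M$ is a finite multiset of splits. For $\mathfrak S=\{S_1,\dots,S_n\}$ (repetitions allowed), the split-containment graph $\Gamma(\mathfrak S)$ is the digraph with vertex multiset $\{(A,S_i):A\in S_i,\ 1\le i\le n\}$ and an arc from $(A,S_i)$ to $(B,S_j)$ whenever $i\neq j$ and $A\subsetneq B$. Let $D_1$ be the digraph on vertices $v,w,p,q$ with arcs $(v,p),(q,w)$. A subgraph $G$ of $\Gamma(\mathfrak S)$ is thin if $V(G)=V(\Gamma(\mathfrak S))$ and for all distinct $i,j$, with $S_i=A|\overline A$, $S_j=B|\overline B$, the subgraph of $G$ induced on $\{(A,S_i),(\overline A,S_i),(B,S_j),(\overline B,S_j)\}$ is isomorphic to $D_1$. An arc $((A,S_i),(B,S_j))$ of $G$ is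 critical if the only directed path in $G$ from $(A,S_i)$ to $(B,S_j)$ is that arc. $\mathcal C_G((A,S_i))$ is the set of vertices $(B,S_j)$ with $((B,S_j),(A,S_i))$ a critical arc of $G$. A thin subgraph $G$ is consistent if for every vertex $(A,S_i)$, $\bigcup_{(B,S_j)\in\mathcal C_G((A,S_i))}B\subseteq A$ (multiset union). -}

module Defs where

open import Data.Nat using (ℕ; zero; suc; _+_; _≤_; _<_)
open import Data.Fin using (Fin)
open import Data.Bool using (Bool; true; false; not)
open import Data.Product using (Σ; ∃; _×_; _,_; proj₁; proj₂)
open import Data.List using (List; []; _∷_)
open import Data.List.Relation.Unary.All using (All)
open import Data.List.Relation.Unary.Unique.Propositional using (Unique)
open import Relation.Nullary using (¬_)
open import Relation.Binary.PropositionalEquality using (_≡_; _≢_)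
open import Function.Bundles using (_⤖_; _⇔_; Bijection)

Multiset : ℕ → Set
Multiset m = Fin m → ℕ

IsMultiset : {m : ℕ} → Multiset m → Set
IsMultiset M = ∀ x → 1 ≤ M x

_⊆ₘ_ : {m : ℕ} → Multiset m → Multiset m → Set
A ⊆ₘ B = ∀ x → A x ≤ B x

_⊊ₘ_ : {m : ℕ} → Multiset m → Multiset m → Set
A ⊊ₘ B = A ⊆ₘ B × ¬ (∀ x → A x ≡ B x)

_∪ₘ_ : {m : ℕ} → Multiset m → Multiset m → Multiset m
(A ∪ₘ B) x = A x + B x

∅ₘ : {m : ℕ} → Multiset m
∅ₘ x = 0

Nonempty : {m : ℕ} → Multiset m → Set
Nonempty A = ∃ λ x → 0 < A x

record Split {m : ℕ} (M : Multiset m) : Set where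
  field
    part     : Bool → Multiset m
    nonempty : ∀ b → Nonempty (part b)
    covers   : ∀ x → (part true ∪ₘ part false) x ≡ M x

open Split public

-- a split system {S_1,...,S_n} (repetitions allowed)
SplitSystem : {m : ℕ} → Multiset m → ℕ → Set
SplitSystem M n = Fin n → Split M

-- Split-containment graph.  Vertex (i , b) stands for (part (S i) b , S_i).

Vertex : ℕ → Set
Vertex n = Fin n × Bool

module _ {m n : ℕ} {M : Multiset m} (S : SplitSystem M n) where

  side : Vertex n → Multiset m
  side (i , b) = part (S i) b

  ΓArc : Vertex n → Vertex n → Set
  ΓArc (i , a) (j , b) = i ≢ j × (side (i , a) ⊊ₘ side (j , b))

  -- a subgraph of Γ(S) with the full vertex set: a set of arcs of Γ(S)
  record Subgraph : Set₁ where
    field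
      Arc    : Vertex n → Vertex n → Set
      arcInΓ : ∀ {u v} → Arc u v → ΓArc u v

  open Subgraph public

  -- the digraph D_1 on vertices v = 0, w = 1, p = 2, q = 3 with arcs (v,p), (q,w)
  data D₁Arc : Fin 4 → Fin 4 → Set where
    vp : D₁Arc Fin.zero (Fin.suc (Fin.suc Fin.zero))
    qw : D₁Arc (Fin.suc (Fin.suc (Fin.suc Fin.zero))) (Fin.suc Fin.zero)

  quad : Fin n → Fin n → Fin 4 → Vertex n
  quad i j Fin.zero = (i , true)
  quad i j (Fin.suc Fin.zero) = (i , false)
  quad i j (Fin.suc (Fin.suc Fin.zero)) = (j , true)
  quad i j (Fin.suc (Fin.suc (Fin.suc Fin.zero))) = (j , false)

  Thin : Subgraph → Set
  Thin G = ∀ (i j : Fin n) → i ≢ j →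
    Σ (Fin 4 ⤖ Fin 4) λ φ → ∀ a b →
      Arc G (quad i j a) (quad i j b) ⇔ D₁Arc (Bijection.to φ a) (Bijection.to φ b)

  -- directed walks in G with k arcs (G is acyclic, so walks are paths)
  data PathIn (G : Subgraph) : Vertex n → Vertex n → ℕ → Set where
    arc  : ∀ {u v} → Arc G u v → PathIn G u v 1
    _∷ₚ_ : ∀ {u w v k} → Arc G u w → PathIn G w v k → PathIn G u v (suc k)

  -- critical arc: an arc such that there is no other directed path (i.e. none
  -- with at least two arcs) from its tail to its head
  Critical : Subgraph → Vertex n → Vertex n → Set
  Critical G u v = Arc G u v × ¬ (∃ λ k → PathIn G u v (suc (suc k)))

  ⋃sides : List (Vertex n) → Multiset m
  ⋃sides [] = ∅ₘ
  ⋃sides (w ∷ ws) = side w ∪ₘ ⋃sides ws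

  -- Since C_G(u) is finite and union is
  -- monotone, this is phrased over every duplicate-free list of members of C_G(u).
  Consistent : Subgraph → Set
  Consistent G = ∀ (u : Vertex n) (L : List (Vertex n)) → Unique L →
    All (λ w → Critical G w u) L → ⋃sides L ⊆ₘ side u

-- Thinness makes the arcs between the four sides of two splits a perfect matching, so arcs
-- and critical arcs are closed under u ⇢ v ↦ v̄ ⇢ ū, while consistency says that distinct
-- critical in-neighbours Y, Z of P satisfy Y ∪ Z ⊆ P.  Write X = (Ā,S_i), P = (B,S_j) and
-- R = (C,S_k).  In the matching between S_i and S_k, X is joined to R by an arc X ⇢ R: every
-- other option yields a detour around X → P or C̄ → P, or C ⊆ Ā and hence M = C ∪ C̄ ⊆ B.
-- A detour X ⇝ R refines (in the double-negation monad, criticality being undecidable) into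
-- critical arcs X → V ⇝ Y → R.  The first arc forces V = P and the complement of the last
-- forces Ȳ = P, so there is a critical path P ⇝ P̄.  Peeling the end arcs w → … → y off such a
-- path leaves a shorter one unless y ≠ w̄, in which case w ⊆ y and y ∪ w̄ ⊆ P̄ give M ⊆ P̄.

module Submission where

open import Defs
open import Data.Nat using (ℕ; zero; suc; _+_; _≤_; _<_; z≤n; s≤s; s≤s⁻¹)
open import Data.Nat.Properties
open import Data.Fin using (Fin) renaming (zero to #0; suc to fsuc)
import Data.Fin as Fin
open import Data.Bool using (Bool; true; false; not)
import Data.Bool as Bool
open import Data.Bool.Properties using (not-involutive; not-¬; ¬-not)
open import Data.Product using (∃; _×_; _,_; proj₁; proj₂)
open import Data.Product.Properties using (≡-dec)
open import Data.Empty using (⊥; ⊥-elim)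
open import Data.List using ([]; _∷_)
open import Data.List.Relation.Unary.All using ([]; _∷_)
open import Data.List.Relation.Unary.AllPairs using ([]; _∷_)
open import Effect.Monad using (RawMonad)
open import Function.Base using (_∘_)
open import Function.Bundles using (_⤖_; _⇔_; Bijection; Equivalence)
open import Level using (0ℓ)
open import Relation.Binary.Construct.Closure.Symmetric using (SymClosure; fwd; bwd; symmetric)
open import Relation.Binary.PropositionalEquality
open import Relation.Nullary using (¬_; Dec; yes; no; contradiction)
open import Relation.Nullary.Decidable using (¬¬-excluded-middle)
open import Relation.Nullary.Negation using (¬¬-Monad)

pattern #1 = fsuc #0
pattern #2 = fsuc (fsuc #0)
pattern #3 = fsuc (fsuc (fsuc #0))

private
  variable
    m n k l : ℕ

card : Multiset m → ℕ
card {zero}  A = 0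
card {suc m} A = A #0 + card (A ∘ fsuc)

card-mono-⊆ₘ : {A B : Multiset m} → A ⊆ₘ B → card A ≤ card B
card-mono-⊆ₘ {zero}  _   = z≤n
card-mono-⊆ₘ {suc m} A⊆B = +-mono-≤ (A⊆B #0) (card-mono-⊆ₘ (A⊆B ∘ fsuc))

card-mono-⊊ₘ : {A B : Multiset m} → A ⊊ₘ B → card A < card B
card-mono-⊊ₘ {zero}  (_ , A≢B) = ⊥-elim (A≢B λ ())
card-mono-⊊ₘ {suc m} {A} {B} (A⊆B , A≢B) with A #0 ≟ B #0
... | no  head≢ = +-mono-<-≤ (≤∧≢⇒< (A⊆B #0) head≢) (card-mono-⊆ₘ (A⊆B ∘ fsuc))
... | yes head≡ = +-mono-≤-< (A⊆B #0) (card-mono-⊊ₘ (A⊆B ∘ fsuc , λ tail≡ →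
  A≢B λ { #0 → head≡ ; (fsuc x) → tail≡ x }))

record Partition {m : ℕ} (M A A′ : Multiset m) : Set where
  constructor partition
  field
    sums : ∀ x → A x + A′ x ≡ M x

open Partition

partition-sym : {M A A′ : Multiset m} → Partition M A A′ → Partition M A′ A
partition-sym {A = A} {A′} MA = partition λ x → trans (+-comm (A′ x) (A x)) (sums MA x)

⊆ₘ-partition-flip : {M A A′ B B′ : Multiset m} → Partition M A A′ → Partition M B B′ →
  A ⊆ₘ B′ → B ⊆ₘ A′
⊆ₘ-partition-flip {A = A} {A′} {B} {B′} MA MB A⊆B′ x =
  +-cancelʳ-≤ (A x) (B x) (A′ x) (begin
    B x + A x   ≤⟨ +-monoʳ-≤ (B x) (A⊆B′ x) ⟩
    B x + B′ x  ≡⟨ trans (sums MB x) (sym (sums MA x)) ⟩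
    A x + A′ x  ≡⟨ +-comm (A x) (A′ x) ⟩
    A′ x + A x  ∎)
  where open ≤-Reasoning

⊆ₘ-partition-cover : {M W W′ A U : Multiset m} → Partition M W W′ → W ⊆ₘ A →
  (A ∪ₘ W′) ⊆ₘ U → M ⊆ₘ U
⊆ₘ-partition-cover {M = M} {W} {W′} {A} MW W⊆A A∪W′⊆U x = begin
  M x          ≡⟨ sym (sums MW x) ⟩
  W x + W′ x   ≤⟨ +-monoˡ-≤ (W′ x) (W⊆A x) ⟩
  A x + W′ x   ≤⟨ A∪W′⊆U x ⟩
  _            ∎
  where open ≤-Reasoning

module Isomorphic-to-D₁ {m n : ℕ} {M : Multiset m} (S : SplitSystem M n)
  {V : Set} (ℓ : Fin 4 → V) (_⇢_ : V → V → Set) (φ : Fin 4 ⤖ Fin 4)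
  (ℓ≅D₁ : ∀ a b → ℓ a ⇢ ℓ b ⇔ D₁Arc S (Bijection.to φ a) (Bijection.to φ b)) where

  open Bijection φ using (to; injective; strictlySurjective)

  D₁-neighbour : ∀ x → ∃ λ y → SymClosure (D₁Arc S) x y
  D₁-neighbour #0 = #2 , fwd vp
  D₁-neighbour #1 = #3 , bwd qw
  D₁-neighbour #2 = #0 , bwd vp
  D₁-neighbour #3 = #1 , fwd qw

  D₁-neighbour-unique : ∀ {x y z} → SymClosure (D₁Arc S) x y → SymClosure (D₁Arc S) x z → y ≡ z
  D₁-neighbour-unique (fwd vp) (fwd vp) = refl
  D₁-neighbour-unique (fwd qw) (fwd qw) = refl
  D₁-neighbour-unique (bwd vp) (bwd vp) = refl
  D₁-neighbour-unique (bwd qw) (bwd qw) = refl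

  to-D₁ : ∀ a b → SymClosure _⇢_ (ℓ a) (ℓ b) → SymClosure (D₁Arc S) (to a) (to b)
  to-D₁ a b (fwd r) = fwd (Equivalence.to (ℓ≅D₁ a b) r)
  to-D₁ a b (bwd r) = bwd (Equivalence.to (ℓ≅D₁ b a) r)

  from-D₁ : ∀ a b → SymClosure (D₁Arc S) (to a) (to b) → SymClosure _⇢_ (ℓ a) (ℓ b)
  from-D₁ a b (fwd r) = fwd (Equivalence.from (ℓ≅D₁ a b) r)
  from-D₁ a b (bwd r) = bwd (Equivalence.from (ℓ≅D₁ b a) r)

  neighbour : ∀ a → ∃ λ b → SymClosure _⇢_ (ℓ a) (ℓ b)
  neighbour a with D₁-neighbour (to a)
  ... | y , a~y with strictlySurjective y
  ...   | b , refl = b , from-D₁ a b a~y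

  neighbour-unique : ∀ a b c → SymClosure _⇢_ (ℓ a) (ℓ b) → SymClosure _⇢_ (ℓ a) (ℓ c) → b ≡ c
  neighbour-unique a b c a~b a~c = injective (D₁-neighbour-unique (to-D₁ a b a~b) (to-D₁ a c a~c))

compl : Vertex n → Vertex n
compl (i , b) = i , not b

compl-involutive : (u : Vertex n) → compl (compl u) ≡ u
compl-involutive (i , b) = cong (i ,_) (not-involutive b)

compl≢ : (u : Vertex n) → compl u ≢ u
compl≢ (i , b) = not-¬ refl ∘ sym ∘ cong proj₂

module Split-system-properties {m n : ℕ} {M : Multiset m} (S : SplitSystem M n) where

  side-compl : (u : Vertex n) → Partition M (side S u) (side S (compl u))
  side-compl (i , true)  = partition (covers (S i))
  side-compl (i , false) = partition-sym (partition (covers (S i)))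

  M⊈side : (v : Vertex n) → ¬ (M ⊆ₘ side S v)
  M⊈side v@(i , b) M⊆v with nonempty (S i) (not b)
  ... | x , compl-v-x>0 =
    <⇒≱ (subst (side S v x <_) (sums (side-compl v) x) (m<m+n _ compl-v-x>0)) (M⊆v x)

module Subgraph-properties {m n : ℕ} {M : Multiset m} {S : SplitSystem M n} (G : Subgraph S) where

  open Split-system-properties S public

  private
    variable
      u v w : Vertex n

  arc-split≢ : Arc G u v → proj₁ u ≢ proj₁ v
  arc-split≢ = proj₁ ∘ arcInΓ G

  arc-⊆ₘ : Arc G u v → side S u ⊆ₘ side S v
  arc-⊆ₘ = proj₁ ∘ proj₂ ∘ arcInΓ G

  arc-card< : Arc G u v → card (side S u) < card (side S v)
  arc-card< = card-mono-⊊ₘ ∘ proj₂ ∘ arcInΓ G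

  ¬parallel-arcs : Arc G u v → Arc G (compl u) (compl v) → ⊥
  ¬parallel-arcs {u} {v} u⇢v ū⇢v̄ = proj₂ (proj₂ (arcInΓ G u⇢v)) λ x →
    ≤-antisym (arc-⊆ₘ u⇢v x)
      (⊆ₘ-partition-flip (partition-sym (side-compl u)) (side-compl v) (arc-⊆ₘ ū⇢v̄) x)

  path-card< : PathIn S G u v k → card (side S u) < card (side S v)
  path-card< (arc a)    = arc-card< a
  path-card< (a ∷ₚ p)   = <-trans (arc-card< a) (path-card< p)

  _∷ʳ_ : PathIn S G u w k → Arc G w v → PathIn S G u v (suc k)
  arc b    ∷ʳ a = b ∷ₚ arc a
  (b ∷ₚ p) ∷ʳ a = b ∷ₚ (p ∷ʳ a)

  Detour : Vertex n → Vertex n → Set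
  Detour u v = ∃ λ k → PathIn S G u v (suc (suc k))

  critical-no-detour : Critical S G u v → PathIn S G u w k → Arc G w v → ⊥
  critical-no-detour (_ , direct) (arc b)  a = direct (0 , b ∷ₚ arc a)
  critical-no-detour (_ , direct) (b ∷ₚ p) a = direct (_ , b ∷ₚ (p ∷ʳ a))

  infixr 5 _◅_ _◅◅_

  data CriticalPath : Vertex n → Vertex n → ℕ → Set where
    ε   : CriticalPath u u 0
    _◅_ : Critical S G u w → CriticalPath w v k → CriticalPath u v (suc k)

  _◅◅_ : CriticalPath u w k → CriticalPath w v l → CriticalPath u v (k + l)
  ε       ◅◅ q = q
  (c ◅ p) ◅◅ q = c ◅ (p ◅◅ q)

  initLast : CriticalPath u v (suc k) → ∃ λ w → CriticalPath u w k × Critical S G w v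
  initLast (c ◅ ε)       = _ , ε , c
  initLast (c ◅ c′ ◅ p) with initLast (c′ ◅ p)
  ... | w , q , w→v = w , c ◅ q , w→v

  criticalPath⇒path : CriticalPath u v (suc k) → PathIn S G u v (suc k)
  criticalPath⇒path (c ◅ ε)      = arc (proj₁ c)
  criticalPath⇒path (c ◅ c′ ◅ p) = proj₁ c ∷ₚ criticalPath⇒path (c′ ◅ p)

  criticalPath-⊆ₘ : CriticalPath u v k → side S u ⊆ₘ side S v
  criticalPath-⊆ₘ ε       x = ≤-refl
  criticalPath-⊆ₘ (c ◅ p) x = ≤-trans (arc-⊆ₘ (proj₁ c) x) (criticalPath-⊆ₘ p x)

  Refinement : Vertex n → Vertex n → ℕ → Set
  Refinement u v k = ∃ λ k′ → k ≤ k′ × CriticalPath u v k′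

  _++ᵣ_ : Refinement u w k → Refinement w v l → Refinement u v (k + l)
  (_ , k≤ , p) ++ᵣ (_ , l≤ , q) = _ , +-mono-≤ k≤ l≤ , p ◅◅ q

  open RawMonad (¬¬-Monad {0ℓ}) using (_>>=_; return)

  -- N bounds the card gap between the endpoints; every arc of a detour has a smaller gap.
  refine-arc : ∀ {u v} N → card (side S v) < N + card (side S u) → Arc G u v → ¬ ¬ Refinement u v 1
  refine-path : ∀ N → card (side S v) < N + card (side S u) → PathIn S G u v k →
    ¬ ¬ Refinement u v k

  refine-arc zero h a _ = <-asym (arc-card< a) h
  refine-arc {u} {v} (suc N) h a = do
    yes (_ , a₁ ∷ₚ p) ← ¬¬-excluded-middle {A = Detour u v}
      where no direct → return (1 , ≤-refl , (a , direct) ◅ ε)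
    r₁ ← refine-arc N (<-≤-trans (path-card< p) v≤) a₁
    r₂ ← refine-path N (≤-<-trans v≤ (+-monoʳ-< N (arc-card< a₁))) p
    let (_ , 2≤ , q) = r₁ ++ᵣ r₂
    return (_ , ≤-trans (s≤s z≤n) 2≤ , q)
    where
    v≤ : card (side S v) ≤ N + card (side S u)
    v≤ = s≤s⁻¹ h

  refine-path N h (arc a)  = refine-arc N h a
  refine-path N h (a ∷ₚ p) = do
    r₁ ← refine-arc N (<-trans (path-card< p) h) a
    r₂ ← refine-path N (<-≤-trans h (+-monoʳ-≤ N (<⇒≤ (arc-card< a)))) p
    return (r₁ ++ᵣ r₂)

  refine : ∀ {u v k} → PathIn S G u v k → ¬ ¬ Refinement u v k
  refine {v = v} = refine-path (suc (card (side S v))) (s≤s (m≤m+n _ _))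

module Thin-properties {m n : ℕ} {M : Multiset m} {S : SplitSystem M n} (G : Subgraph S)
  (thin : Thin S G) where

  open Subgraph-properties G

  private
    variable
      u v : Vertex n

  Linked : Vertex n → Vertex n → Set
  Linked = SymClosure (Arc G)

  ¬linked-within-split : ∀ {i x y} → ¬ Linked (i , x) (i , y)
  ¬linked-within-split (fwd a) = arc-split≢ a refl
  ¬linked-within-split (bwd a) = arc-split≢ a refl

  module _ {p q : Fin n} (p≢q : p ≢ q) where

    private
      open Isomorphic-to-D₁ S (quad S p q) (Arc G) (proj₁ (thin p q p≢q)) (proj₂ (thin p q p≢q))

      across : ∀ {x} → ∃ (λ b → Linked (p , x) (quad S p q b)) → ∃ λ y → Linked (p , x) (q , y)
      across (#0 , l) = ⊥-elim (¬linked-within-split l)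
      across (#1 , l) = ⊥-elim (¬linked-within-split l)
      across (#2 , l) = true , l
      across (#3 , l) = false , l

      shared-neighbour : ∀ c b b′ → Linked (quad S p q b) (quad S p q c) →
        Linked (quad S p q b′) (quad S p q c) → b ≡ b′
      shared-neighbour c b b′ l l′ = neighbour-unique c b b′ (symmetric _ l) (symmetric _ l′)

    linked-across : ∀ x → ∃ λ y → Linked (p , x) (q , y)
    linked-across true  = across (neighbour #0)
    linked-across false = across (neighbour #1)

    linked-across-unique : ∀ {x x′ y} → Linked (p , x) (q , y) → Linked (p , x′) (q , y) → x ≡ x′
    linked-across-unique {true}  {true}          _ _  = refl
    linked-across-unique {false} {false}         _ _  = refl
    linked-across-unique {true}  {false} {true}  l l′ = contradiction (shared-neighbour #2 #0 #1 l l′) λ ()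
    linked-across-unique {true}  {false} {false} l l′ = contradiction (shared-neighbour #3 #0 #1 l l′) λ ()
    linked-across-unique {false} {true}  {true}  l l′ = contradiction (shared-neighbour #2 #1 #0 l l′) λ ()
    linked-across-unique {false} {true}  {false} l l′ = contradiction (shared-neighbour #3 #1 #0 l l′) λ ()

  -- The matching partner of u ⇢ v cannot be ū ⇢ v̄, so it is v̄ ⇢ ū.
  arc-compl : Arc G u v → Arc G (compl v) (compl u)
  arc-compl {p , x} {q , y} u⇢v with linked-across (arc-split≢ u⇢v) (not x)
  ... | y′ , ū~ with y′ Bool.≟ y
  ...   | yes refl = contradiction (linked-across-unique (arc-split≢ u⇢v) (fwd u⇢v) ū~) (not-¬ refl)
  ...   | no y′≢y with ¬-not y′≢y | ū~
  ...     | refl | fwd ū⇢v̄ = ⊥-elim (¬parallel-arcs u⇢v ū⇢v̄)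
  ...     | refl | bwd v̄⇢ū = v̄⇢ū

  path-compl : PathIn S G u v k → PathIn S G (compl v) (compl u) k
  path-compl (arc a)  = arc (arc-compl a)
  path-compl (a ∷ₚ p) = path-compl p ∷ʳ arc-compl a

  critical-compl : Critical S G u v → Critical S G (compl v) (compl u)
  critical-compl {u} {v} (u⇢v , direct) = arc-compl u⇢v , λ (_ , p) →
    direct (_ , subst₂ (λ s t → PathIn S G s t _) (compl-involutive u) (compl-involutive v)
                  (path-compl p))

module Consistent-thin-properties {m n : ℕ} {M : Multiset m} {S : SplitSystem M n} (G : Subgraph S)
  (thin : Thin S G) (consistent : Consistent S G) where

  open Subgraph-properties G
  open Thin-properties G thin

  private
    variable
      P Q R V X Y Z : Vertex n

  _≟ᵥ_ : (u v : Vertex n) → Dec (u ≡ v)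
  _≟ᵥ_ = ≡-dec Fin._≟_ Bool._≟_

  consistent-pair : Critical S G Y P → Critical S G Z P → Y ≢ Z → (side S Y ∪ₘ side S Z) ⊆ₘ side S P
  consistent-pair {Y} {P} {Z} Y→P Z→P Y≢Z x =
    subst (_≤ side S P x) (cong (side S Y x +_) (+-identityʳ (side S Z x)))
      (consistent P (Y ∷ Z ∷ []) ((Y≢Z ∷ []) ∷ [] ∷ []) (Y→P ∷ Z→P ∷ []) x)

  ¬critical-to-both-sides : Critical S G X P → Critical S G X (compl P) → ⊥
  ¬critical-to-both-sides {X} {P} X→P X→P̄ = M⊈side (compl X)
    (⊆ₘ-partition-cover (side-compl (compl P)) (λ _ → ≤-refl)
      (consistent-pair (critical-compl X→P) (critical-compl X→P̄) (compl≢ (compl P) ∘ sym)))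

  criticalPath-end≢compl : ∀ {u v k} → CriticalPath u v k → v ≢ compl u
  criticalPath-end≢compl {u} ε u≡ū = compl≢ u (sym u≡ū)
  criticalPath-end≢compl {i , b} (u→v ◅ ε) v≡ū = arc-split≢ (proj₁ u→v) (sym (cong proj₁ v≡ū))
  criticalPath-end≢compl {v = v} {k = suc (suc k)} (_◅_ {w = w} u→w w⇝v) v≡ū with initLast w⇝v
  ... | y , w⇝y , y→v with y ≟ᵥ compl w
  ...   | yes y≡w̄ = criticalPath-end≢compl w⇝y y≡w̄
  ...   | no  y≢w̄ = M⊈side v (⊆ₘ-partition-cover (side-compl w) (criticalPath-⊆ₘ w⇝y)
            (consistent-pair y→v (subst (Critical S G (compl w)) (sym v≡ū) (critical-compl u→w))
              y≢w̄))

  ¬critical-successor-across : Critical S G X P → Critical S G Q P → Critical S G X V →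
    PathIn S G Q (compl V) (suc k) → proj₁ V ≢ proj₁ P → ⊥
  ¬critical-successor-across {X} {P = j , b} {V = l , z} X→P Q→P X→V Q⇝V̄ l≢j
    with linked-across (l≢j ∘ sym) b
  ... | y , P~ with y Bool.≟ z | P~
  ...   | yes refl | fwd P⇢V = critical-no-detour X→V (arc (proj₁ X→P)) P⇢V
  ...   | yes refl | bwd V⇢P = critical-no-detour X→P (arc (proj₁ X→V)) V⇢P
  ...   | no  y≢z  | P~′ with ¬-not y≢z | P~′
  ...     | refl | bwd V̄⇢P = critical-no-detour Q→P Q⇝V̄ V̄⇢P
  ...     | refl | fwd P⇢V̄ = M⊈side (compl X)
            (⊆ₘ-partition-cover (side-compl (l , z))
              (⊆ₘ-partition-flip (side-compl (j , b)) (side-compl (l , z)) (arc-⊆ₘ P⇢V̄))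
              (consistent-pair (critical-compl X→P) (critical-compl X→V) (l≢j ∘ sym ∘ cong proj₁)))

  critical-successor-unique : Critical S G X P → Critical S G Q P → Critical S G X V →
    PathIn S G Q (compl V) (suc k) → V ≡ P
  critical-successor-unique {P = j , b} {V = l , z} X→P Q→P X→V Q⇝V̄ with l Fin.≟ j
  ... | no  l≢j = ⊥-elim (¬critical-successor-across X→P Q→P X→V Q⇝V̄ l≢j)
  ... | yes refl with z Bool.≟ b
  ...   | yes refl = refl
  ...   | no  z≢b rewrite ¬-not z≢b = ⊥-elim (¬critical-to-both-sides X→P X→V)

  arc-to-compl : proj₁ X ≢ proj₁ R → Critical S G X P → Critical S G (compl R) P → Arc G X R
  arc-to-compl {_ , x} {k , c} {P} X≢R X→P R̄→P with linked-across X≢R x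
  ... | y , X~ with y Bool.≟ c | X~
  ...   | yes refl | fwd X⇢R = X⇢R
  ...   | yes refl | bwd R⇢X = ⊥-elim (M⊈side P
          (⊆ₘ-partition-cover (side-compl (k , c)) (arc-⊆ₘ R⇢X)
            (consistent-pair X→P R̄→P (X≢R ∘ cong proj₁))))
  ...   | no  y≢c  | X~′ with ¬-not y≢c | X~′
  ...     | refl | fwd X⇢R̄ = ⊥-elim (critical-no-detour X→P (arc X⇢R̄) (proj₁ R̄→P))
  ...     | refl | bwd R̄⇢X = ⊥-elim (critical-no-detour R̄→P (arc R̄⇢X) (proj₁ X→P))

  ¬critical-detour : ∀ {k} → Critical S G X P → Critical S G (compl R) P → Critical S G X V →
    CriticalPath V R (suc k) → ⊥
  ¬critical-detour {X} {P} {R} {V} X→P R̄→P X→V V⇝R with initLast V⇝R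
  ... | Y , V⇝Y , Y→R = criticalPath-end≢compl V⇝Y Y≡V̄
    where
    V≡P : V ≡ P
    V≡P = critical-successor-unique X→P R̄→P X→V (path-compl (criticalPath⇒path V⇝R))

    Ȳ≡P : compl Y ≡ P
    Ȳ≡P = critical-successor-unique R̄→P X→P (critical-compl Y→R)
      (subst (λ t → PathIn S G X t _) (sym (compl-involutive Y)) (criticalPath⇒path (X→V ◅ V⇝Y)))

    Y≡V̄ : Y ≡ compl V
    Y≡V̄ = begin
      Y                ≡⟨ compl-involutive Y ⟨
      compl (compl Y)  ≡⟨ cong compl (trans Ȳ≡P (sym V≡P)) ⟩
      compl V          ∎
      where open ≡-Reasoning

  ¬detour : Critical S G X P → Critical S G (compl R) P → ¬ Detour X R
  ¬detour X→P R̄→P (_ , X⇝R) = refine X⇝R λ where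
    (suc (suc _) , _ , X→V ◅ V⇝R) → ¬critical-detour X→P R̄→P X→V V⇝R
    (suc zero , s≤s () , _)

  critical-to-compl : proj₁ X ≢ proj₁ R → Critical S G X P → Critical S G (compl R) P →
    Critical S G X R
  critical-to-compl X≢R X→P R̄→P = arc-to-compl X≢R X→P R̄→P , ¬detour X→P R̄→P

lemma3 : {m n : ℕ} (M : Multiset m) → IsMultiset M → 1 ≤ n →
    (S : SplitSystem M n) (G : Subgraph S) → Thin S G → Consistent S G →
    (i j k : Fin n) (a b c : Bool) → i ≢ k →
    Critical S G (i , not a) (j , b) →
    Critical S G (k , not c) (j , b) →
    Critical S G (i , not a) (k , c)
lemma3 _ _ _ _ G thin consistent _ _ _ _ _ _ =
  Consistent-thin-properties.critical-to-compl G thin consistent
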